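{- Let $f(x,y,z)=3x^2+25y^2+25z^2-10xy-10xz$ and $g(x,y,z)=2x^2+25y^2+25z^2-10xy$. For any positive integer $n$: (i) if $n$ is square-free, then $n$ is represented by the genus of $f$ if and only if $n\not\equiv 7\pmod 8$ and $n\equiv 2$ or $3\pmod 5$; (ii) if $n\equiv 2\pmod 5$ and $n$ is represented by $f$, then $n$ is a sum of three nonunit squares; (iii) if $n\equiv 3\pmod 5$ and $n$ is represented by $g$, then $n$ is a sum of three nonunit squares.
   Context: A form $h$ represents $n$ if $h(x,y,z)=n$ has a solution in $\mathbb{Z}^3$. An integer $n$ is represented by the genus of $f$ if $n$ is represented by $f$ over $\mathbb{Z}_p$ for every prime $p$ and over $\mathbb{R}$ (equivalently, by some form in the genus of $f$). A positive integer $n$ is a sum of three nonunit squares if there exist integers $x,y,z$ with $n=x^2+y^2+z^2$ and $(x^2-1)(y^2-1)(z^2-1)\neq 0$. -}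

module Defs where

open import Data.Nat as ℕ using (ℕ; suc; _^_)
open import Data.Nat.Primality using (Prime)
import Data.Nat.Divisibility as ℕD
open import Data.Integer using (ℤ; +_; _+_; _-_; _*_)
open import Data.Integer.Divisibility using (_∣_)
open import Data.Product using (Σ; _×_; ∃)
open import Relation.Binary.PropositionalEquality using (_≡_; _≢_)

Form : Set
Form = ℤ → ℤ → ℤ → ℤ

f : Form
f x y z = + 3 * (x * x) + + 25 * (y * y) + + 25 * (z * z)
          - + 10 * (x * y) - + 10 * (x * z)

g : Form
g x y z = + 2 * (x * x) + + 25 * (y * y) + + 25 * (z * z) - + 10 * (x * y)

Represents : Form → ℕ → Set
Represents h n = Σ ℤ λ x → Σ ℤ λ y → Σ ℤ λ z → h x y z ≡ + n

-- A p-adic integer, as an element of the inverse limit lim ℤ/p^k: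
-- a sequence of integers a₀, a₁, … with a_{k+1} ≡ a_k (mod p^k).
-- (a_k is a representative of the residue modulo p^k.)
Coherent : ℕ → (ℕ → ℤ) → Set
Coherent p a = ∀ k → (+ (p ^ k)) ∣ (a (suc k) - a k)

RepresentsZp : ℕ → Form → ℕ → Set
RepresentsZp p h n =
  Σ (ℕ → ℤ) λ x → Σ (ℕ → ℤ) λ y → Σ (ℕ → ℤ) λ z →
    Coherent p x × Coherent p y × Coherent p z ×
    (∀ k → (+ (p ^ k)) ∣ (h (x k) (y k) (z k) - + n))

RepresentedByGenus : Form → ℕ → Set
RepresentedByGenus h n = ∀ p → Prime p → RepresentsZp p h n

SquareFree : ℕ → Set
SquareFree n = ∀ d → (d ℕ.* d) ℕD.∣ n → d ≡ 1

SumOfThreeNonunitSquares : ℕ → Set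
SumOfThreeNonunitSquares n =
  Σ ℤ λ x → Σ ℤ λ y → Σ ℤ λ z →
    (+ n ≡ x * x + y * y + z * z) ×
    ((x * x - + 1) * (y * y - + 1) * (z * z - + 1) ≢ + 0)

-- f = x² + (x − 5y)² + (x − 5z)² and g = x² + (x − 5y)² + (5z)². Every one of these
-- squares except (5z)² is ≡ x² (mod 5), so f ≡ 3x² and g ≡ 2x² (mod 5); if one of the three
-- squares were 1, then x² ≡ 1 and n would be ≡ 3 (for f) or ≡ 2 (for g) modulo 5.
-- Genus: a sum of three squares is never ≡ 7 (mod 8), which is the 2-adic obstruction, and
-- n ≡ f ≡ 3x² (mod 5) forces n ≡ 2, 3 (mod 5) unless 5 ∣ x, when 25 ∣ f ≡ n (mod 25).
-- Conversely, p-adic representations are obtained by Hensel lifting along one coordinate: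
-- along x from 3x² ≡ n at p = 5; along z from explicit solutions mod 8 at p = 2, where the
-- z-derivative 10(5z − x) is twice a unit; and for the other p from a² + b² + 1 ≡ n (mod p),
-- solvable by pigeonhole, choosing y, z with x − 5y ≡ b and x − 5z ≡ 1 for x = a.

module Submission where

open import Defs
open import Data.Nat as ℕ using (ℕ; zero; suc; _<_; _^_; _%_; _/_; s≤s; NonZero)
import Data.Nat.Properties as ℕ
open import Data.Nat.DivMod using (m%n<n; m≡m%n+[m/n]*n; m∣n⇒o%n%m≡o%m)
open import Data.Nat.Divisibility as ℕ using (m%n≡0⇒n∣m; >⇒∤)
open import Data.Nat.Primality
  using (Prime; prime?; prime[2]; prime⇒irreducible; prime⇒nonTrivial; prime⇒nonZero; euclidsLemma)
open import Data.Nat.Coprimality using (Coprime; coprime-Bézout)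
open import Data.Nat.GCD using (module Bézout)
import Data.Nat.Tactic.RingSolver as ℕ-Solver
open import Data.Integer as ℤ using (ℤ; +_; 0ℤ; _+_; _-_; _*_; -_; ∣_∣)
open import Data.Integer.DivMod using (_%ℕ_; _/ℕ_; n%ℕd<d; a≡a%ℕn+[a/ℕn]*n)
open import Data.Integer.Properties
  using ( pos-*; pos-+; +-inverseʳ; +-identityʳ; *-identityʳ; *-identityˡ; *-distribʳ-+; *-assoc; *-comm
        ; neg-distribˡ-*; abs-*; ∣i-j∣≤∣i∣+∣j∣; ∣i∣≡0⇒i≡0; i-j≡0⇒i≡j; +-injective; i*j≡0⇒i≡0∨j≡0)
open import Data.Integer.Divisibility.Signed
  using (_∣_; divides; ∣⇒∣ᵤ; ∣ᵤ⇒∣; ∣-refl; ∣-trans; ∣m∣n⇒∣m+n; ∣m⇒∣-m; ∣n⇒∣m*n; ∣m⇒∣m*n; _∣?_)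
import Data.Integer.Divisibility as Unsigned
open import Data.Integer.Tactic.RingSolver using (solve-∀)
open import Data.Fin as F using (Fin; toℕ; fromℕ<; splitAt; join)
open import Data.Fin.Properties using (toℕ<n; toℕ-injective; toℕ-fromℕ<; pigeonhole; join-splitAt; <-irrefl; all?)
open import Data.Product using (Σ; _×_; _,_)
open import Data.Sum using (_⊎_; inj₁; inj₂; [_,_]′)
open import Function using (id; _∘_)
open import Function.Bundles using (_⇔_; mk⇔)
open import Level using (0ℓ)
open import Relation.Binary.Bundles using (Setoid)
import Relation.Binary.Reasoning.Setoid
open import Relation.Binary.PropositionalEquality
open import Relation.Nullary using (¬_; ¬?; contradiction; yes; no)
open import Relation.Nullary.Decidable using (Dec; map′; toWitness; toWitnessFalse; _→-dec_; _⊎-dec_)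

-- A record rather than an abbreviation of + m ∣ a - b, so that a and b stay inferable.
infix 4 _≡_mod_
record _≡_mod_ (a b : ℤ) (m : ℕ) : Set where
  constructor ≡-mod
  field
    ∣-difference : + m ∣ a - b

open _≡_mod_ public

module _ {m : ℕ} where

  ≡⇒≡-mod : ∀ {a b} → a ≡ b → a ≡ b mod m
  ≡⇒≡-mod {a} refl = ≡-mod (divides 0ℤ (+-inverseʳ a))

  ≡-mod-refl : ∀ {a} → a ≡ a mod m
  ≡-mod-refl = ≡⇒≡-mod refl

  ≡-mod-sym : ∀ {a b} → a ≡ b mod m → b ≡ a mod m
  ≡-mod-sym {a} {b} (≡-mod m∣a-b) = ≡-mod (subst (+ m ∣_) (negate a b) (∣m⇒∣-m m∣a-b))
    where
    negate : ∀ a b → - (a - b) ≡ b - a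
    negate = solve-∀

  ≡-mod-trans : ∀ {a b c} → a ≡ b mod m → b ≡ c mod m → a ≡ c mod m
  ≡-mod-trans {a} {b} {c} (≡-mod m∣a-b) (≡-mod m∣b-c) =
    ≡-mod (subst (+ m ∣_) (telescope a b c) (∣m∣n⇒∣m+n m∣a-b m∣b-c))
    where
    telescope : ∀ a b c → (a - b) + (b - c) ≡ a - c
    telescope = solve-∀

  +-cong-mod : ∀ {a b c d} → a ≡ b mod m → c ≡ d mod m → a + c ≡ b + d mod m
  +-cong-mod {a} {b} {c} {d} (≡-mod m∣a-b) (≡-mod m∣c-d) =
    ≡-mod (subst (+ m ∣_) (regroup a b c d) (∣m∣n⇒∣m+n m∣a-b m∣c-d))
    where
    regroup : ∀ a b c d → (a - b) + (c - d) ≡ (a + c) - (b + d)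
    regroup = solve-∀

  *-cong-mod : ∀ {a b c d} → a ≡ b mod m → c ≡ d mod m → a * c ≡ b * d mod m
  *-cong-mod {a} {b} {c} {d} (≡-mod m∣a-b) (≡-mod m∣c-d) =
    ≡-mod (subst (+ m ∣_) (regroup a b c d) (∣m∣n⇒∣m+n (∣m⇒∣m*n c m∣a-b) (∣n⇒∣m*n b m∣c-d)))
    where
    regroup : ∀ a b c d → (a - b) * c + b * (c - d) ≡ a * c - b * d
    regroup = solve-∀

  square-cong-mod : ∀ {a b} → a ≡ b mod m → a * a ≡ b * b mod m
  square-cong-mod a≡b = *-cong-mod a≡b a≡b

  c-x≡c-y⇒y≡x : ∀ {c x y} → c - x ≡ c - y mod m → y ≡ x mod m
  c-x≡c-y⇒y≡x {c} {x} {y} (≡-mod m∣difference) = ≡-mod (subst (+ m ∣_) (identity c x y) m∣difference)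
    where
    identity : ∀ c x y → (c - x) - (c - y) ≡ y - x
    identity = solve-∀

  x≡c-y⇒x+y≡c : ∀ {c x y} → x ≡ c - y mod m → x + y ≡ c mod m
  x≡c-y⇒x+y≡c {c} {x} {y} (≡-mod m∣difference) = ≡-mod (subst (+ m ∣_) (identity c x y) m∣difference)
    where
    identity : ∀ c x y → x - (c - y) ≡ x + y - c
    identity = solve-∀

  n≡0⇒m∣n : ∀ {n} → + n ≡ 0ℤ mod m → m ℕ.∣ n
  n≡0⇒m∣n {n} (≡-mod m∣n-0) = subst (m ℕ.∣_) (ℕ.+-identityʳ n) (∣⇒∣ᵤ m∣n-0)

  ≡-mod-weaken : ∀ {k a b} → m ℕ.∣ k → a ≡ b mod k → a ≡ b mod m
  ≡-mod-weaken m∣k (≡-mod k∣a-b) = ≡-mod (∣-trans (∣ᵤ⇒∣ m∣k) k∣a-b)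

infix 4 _≡?_mod_
_≡?_mod_ : ∀ a b m → Dec (a ≡ b mod m)
a ≡? b mod m = map′ ≡-mod ∣-difference (+ m ∣? a - b)

≡-mod-setoid : ℕ → Setoid 0ℓ 0ℓ
≡-mod-setoid m = record
  { Carrier       = ℤ
  ; _≈_           = λ a b → a ≡ b mod m
  ; isEquivalence = record { refl = ≡-mod-refl ; sym = ≡-mod-sym ; trans = ≡-mod-trans }
  }

module ≡-mod-Reasoning (m : ℕ) = Relation.Binary.Reasoning.Setoid (≡-mod-setoid m)

x≡x%ℕm : ∀ x m .{{_ : NonZero m}} → x ≡ + (x %ℕ m) mod m
x≡x%ℕm x m = ≡-mod (divides (x /ℕ m) (begin
  x - + (x %ℕ m)                              ≡⟨ cong (_- + (x %ℕ m)) (a≡a%ℕn+[a/ℕn]*n x m) ⟩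
  + (x %ℕ m) + (x /ℕ m) * + m - + (x %ℕ m)   ≡⟨ cancel (+ (x %ℕ m)) ((x /ℕ m) * + m) ⟩
  (x /ℕ m) * + m                              ∎))
  where
  open ≡-Reasoning
  cancel : ∀ r s → r + s - r ≡ s
  cancel = solve-∀

n%m≡r⇒n≡r : ∀ {n m r} .{{_ : NonZero m}} → n % m ≡ r → + n ≡ + r mod m
n%m≡r⇒n≡r {n} {m} n%m≡r = subst (λ c → + n ≡ + c mod m) n%m≡r (x≡x%ℕm (+ n) m)

residue : ∀ m .{{_ : NonZero m}} → ℤ → Fin m
residue m x = fromℕ< (n%ℕd<d x m)

x≡residue : ∀ x m .{{_ : NonZero m}} → x ≡ + toℕ (residue m x) mod m
x≡residue x m = subst (λ r → x ≡ + r mod m) (sym (toℕ-fromℕ< (n%ℕd<d x m))) (x≡x%ℕm x m)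

same-residue⇒≡-mod : ∀ {m x y} .{{_ : NonZero m}} → residue m x ≡ residue m y → x ≡ y mod m
same-residue⇒≡-mod {m} {x} {y} same =
  ≡-mod-trans (x≡residue x m) (≡-mod-trans (≡⇒≡-mod (cong (λ r → + toℕ r) same)) (≡-mod-sym (x≡residue y m)))

n%m≡r⇒n≢s : ∀ {n m r s} .{{_ : NonZero m}} → n % m ≡ r → ¬ + r ≡ + s mod m → ¬ + n ≡ + s mod m
n%m≡r⇒n≢s n%m≡r r≢s n≡s = r≢s (≡-mod-trans (≡-mod-sym (n%m≡r⇒n≡r n%m≡r)) n≡s)

x-my≡x : ∀ m x y → x - + m * y ≡ x mod m
x-my≡x m x y = ≡-mod (divides (- y) (identity x y (+ m)))
  where
  identity : ∀ x y m → x - m * y - x ≡ - y * m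
  identity = solve-∀

my≡0 : ∀ m y → + m * y ≡ 0ℤ mod m
my≡0 m y = ≡-mod (divides y (identity y (+ m)))
  where
  identity : ∀ y m → m * y - 0ℤ ≡ y * m
  identity = solve-∀

-- Hensel lifting

ZpRoot : ℕ → (ℤ → ℤ) → Set
ZpRoot p F = Σ (ℕ → ℤ) λ t → Coherent p t × (∀ k → + (p ^ k) Unsigned.∣ F (t k))

-- Newton's iteration for a quadratic F. With D = 1 this is Hensel's lemma for a simple root;
-- D = 2 covers p = 2, where one starts from a root mod 8 at which F′ is only twice a unit.
module _ (p : ℕ) {F F′ : ℤ → ℤ} (A : ℤ)
         (expand : ∀ t s → F (t + s) ≡ F t + F′ t * s + A * (s * s))
         (expand′ : ∀ t s → F′ (t + s) ≡ F′ t + + 2 * A * s)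
         (D w : ℤ) where

  private
    P : ℤ
    P = + p

    pw : ℕ → ℤ
    pw j = + (p ^ j)

  record Approximation (j : ℕ) : Set where
    constructor approximation
    field
      root value-quotient slope-quotient : ℤ
      value-≡ : F root ≡ value-quotient * (D * D * P * pw j)
      slope-≡ : F′ root * w ≡ D + slope-quotient * (D * P)

  private
    correction : ℕ → ℤ → ℤ
    correction j q = w * (- (q * D * P) * pw j)

  refine : ∀ {j} → Approximation j → Approximation (suc j)
  refine {j} (approximation t q r value-≡ slope-≡) = approximation (t + δ) q′ r′ value′ slope′
    where
    open ≡-Reasoning

    ε = - (q * D * P) * pw j
    δ = correction j q
    q′ = A * q * q * w * w * pw j - q * r
    r′ = r - + 2 * A * q * w * w * pw j

    newton : ∀ q r A D w P π →
      q * (D * D * P * π) + (D + r * (D * P)) * (- (q * D * P) * π)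
        + A * ((w * (- (q * D * P) * π)) * (w * (- (q * D * P) * π)))
      ≡ (A * q * q * w * w * π - q * r) * (D * D * P * (P * π))
    newton = solve-∀

    newton′ : ∀ q r A D w P π →
      D + r * (D * P) + + 2 * A * (w * (- (q * D * P) * π)) * w
      ≡ D + (r - + 2 * A * q * w * w * π) * (D * P)
    newton′ = solve-∀

    value′ : F (t + δ) ≡ q′ * (D * D * P * pw (suc j))
    value′ = begin
      F (t + δ)                                         ≡⟨ expand t δ ⟩
      F t + F′ t * (w * ε) + A * (δ * δ)                ≡⟨ cong (λ u → F t + u + A * (δ * δ)) (sym (*-assoc (F′ t) w ε)) ⟩
      F t + F′ t * w * ε + A * (δ * δ)                  ≡⟨ cong₂ (λ u v → u + v * ε + A * (δ * δ)) value-≡ slope-≡ ⟩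
      q * (D * D * P * pw j) + (D + r * (D * P)) * ε + A * (δ * δ) ≡⟨ newton q r A D w P (pw j) ⟩
      q′ * (D * D * P * (P * pw j))                     ≡⟨ cong (λ π → q′ * (D * D * P * π)) (sym (pos-* p (p ^ j))) ⟩
      q′ * (D * D * P * pw (suc j))                     ∎

    slope′ : F′ (t + δ) * w ≡ D + r′ * (D * P)
    slope′ = begin
      F′ (t + δ) * w                        ≡⟨ cong (_* w) (expand′ t δ) ⟩
      (F′ t + + 2 * A * δ) * w              ≡⟨ *-distribʳ-+ w (F′ t) (+ 2 * A * δ) ⟩
      F′ t * w + + 2 * A * δ * w            ≡⟨ cong (_+ + 2 * A * δ * w) slope-≡ ⟩
      D + r * (D * P) + + 2 * A * δ * w     ≡⟨ newton′ q r A D w P (pw j) ⟩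
      D + r′ * (D * P)                      ∎

  open Approximation using (root)

  refine-coherent : ∀ {j} (a : Approximation j) → pw j ∣ root (refine a) - root a
  refine-coherent {j} (approximation t q _ _ _) =
    subst (pw j ∣_) (sym (cancel t (correction j q))) (∣n⇒∣m*n w (∣n⇒∣m*n (- (q * D * P)) ∣-refl))
    where
    cancel : ∀ t δ → t + δ - t ≡ δ
    cancel = solve-∀

  root-divisible : ∀ {j} (a : Approximation j) → pw j ∣ F (root a)
  root-divisible {j} (approximation _ q _ value-≡ _) =
    subst (pw j ∣_) (sym value-≡) (∣n⇒∣m*n q (∣n⇒∣m*n (D * D * P) ∣-refl))

  approximations : Approximation 0 → (j : ℕ) → Approximation j
  approximations a₀ zero    = a₀
  approximations a₀ (suc j) = refine (approximations a₀ j)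

  hensel : ∀ t₀ → D * D * P ∣ F t₀ → D * P ∣ F′ t₀ * w - D → ZpRoot p F
  hensel t₀ (divides q value-≡) (divides r slope-≡) =
    (λ j → root (approximations a₀ j)) ,
    (λ j → ∣⇒∣ᵤ (refine-coherent (approximations a₀ j))) ,
    (λ j → ∣⇒∣ᵤ (root-divisible (approximations a₀ j)))
    where
    shift : ∀ a b c → a - b ≡ c → a ≡ b + c
    shift a b c a-b≡c = trans (split a b) (cong (λ u → b + u) a-b≡c)
      where
      split : ∀ a b → a ≡ b + (a - b)
      split = solve-∀

    a₀ : Approximation 0
    a₀ = approximation t₀ q r
      (trans value-≡ (cong (q *_) (sym (*-identityʳ (D * D * P)))))
      (shift (F′ t₀ * w) D (r * (D * P)) slope-≡)

prime≢1 : ∀ {p} → Prime p → p ≢ 1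
prime≢1 pp = ℕ.nonTrivial⇒≢1 {{prime⇒nonTrivial pp}}

prime∣prime⇒≡ : ∀ {p q} → Prime p → Prime q → p ℕ.∣ q → p ≡ q
prime∣prime⇒≡ pp pq p∣q = [ (λ p≡1 → contradiction p≡1 (prime≢1 pp)) , id ]′ (prime⇒irreducible pq p∣q)

prime[5] : Prime 5
prime[5] = toWitness {a? = prime? 5} _

prime∤10 : ∀ {p} → Prime p → p ≢ 2 → p ≢ 5 → ¬ p ℕ.∣ 10
prime∤10 pp p≢2 p≢5 p∣10 with euclidsLemma 2 5 pp p∣10
... | inj₁ p∣2 = p≢2 (prime∣prime⇒≡ pp prime[2] p∣2)
... | inj₂ p∣5 = p≢5 (prime∣prime⇒≡ pp prime[5] p∣5)

inverse-mod-prime : ∀ {p} m → Prime p → ¬ p ℕ.∣ m → Σ ℤ λ α → + m * α ≡ + 1 mod p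
inverse-mod-prime {p} m pp p∤m = from-bézout (coprime-Bézout coprime)
  where
  open ≡-Reasoning

  coprime : Coprime m p
  coprime (d∣m , d∣p) = [ id , (λ d≡p → contradiction (subst (ℕ._∣ m) d≡p d∣m) p∤m) ]′ (prime⇒irreducible pp d∣p)

  cast : ∀ a b c d e → a ℕ.+ b ℕ.* c ≡ d ℕ.* e → + a + + b * + c ≡ + d * + e
  cast a b c d e eq = begin
    + a + + b * + c     ≡⟨ cong (λ u → + a + u) (sym (pos-* b c)) ⟩
    + a + + (b ℕ.* c)   ≡⟨ sym (pos-+ a (b ℕ.* c)) ⟩
    + (a ℕ.+ b ℕ.* c)   ≡⟨ cong +_ eq ⟩
    + (d ℕ.* e)         ≡⟨ pos-* d e ⟩
    + d * + e           ∎

  solve-for-quotient : ∀ u v q → + 1 + q ≡ u * v → v * u - + 1 ≡ q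
  solve-for-quotient u v q 1+q≡uv = begin
    v * u - + 1         ≡⟨ cong (_- + 1) (*-comm v u) ⟩
    u * v - + 1         ≡⟨ cong (_- + 1) (sym 1+q≡uv) ⟩
    + 1 + q - + 1       ≡⟨ cancel q ⟩
    q                   ∎
    where
    cancel : ∀ q → + 1 + q - + 1 ≡ q
    cancel = solve-∀

  from-bézout : Bézout.Identity 1 m p → Σ ℤ λ α → + m * α ≡ + 1 mod p
  from-bézout (Bézout.+- x y 1+yp≡xm) =
    + x , ≡-mod (divides (+ y) (solve-for-quotient (+ x) (+ m) (+ y * + p) (cast 1 y p x m 1+yp≡xm)))
  from-bézout (Bézout.-+ x y 1+xm≡yp) =
    - + x , ≡-mod (divides (- + y) (negate (+ m) (+ x) (+ y) (+ p) (cast 1 x m y p 1+xm≡yp)))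
    where
    negate : ∀ m x y p → + 1 + x * m ≡ y * p → m * - x - + 1 ≡ - y * p
    negate m x y p 1+xm≡yp = begin
      m * - x - + 1       ≡⟨ rearrange m x ⟩
      - (+ 1 + x * m)     ≡⟨ cong -_ 1+xm≡yp ⟩
      - (y * p)           ≡⟨ neg-distribˡ-* y p ⟩
      - y * p             ∎
      where
      rearrange : ∀ m x → m * - x - + 1 ≡ - (+ 1 + x * m)
      rearrange = solve-∀

odd-prime≡2h+1 : ∀ {p} → Prime p → p ≢ 2 → p ≡ suc (p / 2 ℕ.+ p / 2)
odd-prime≡2h+1 {p} pp p≢2 with p % 2 | m≡m%n+[m/n]*n p 2 | m%n<n p 2
... | 0 | p≡[p/2]*2 | _ = contradiction (sym (prime∣prime⇒≡ prime[2] pp (ℕ.divides (p / 2) p≡[p/2]*2))) p≢2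
... | 1 | p≡1+[p/2]*2 | _ = trans p≡1+[p/2]*2 (cong suc (double (p / 2)))
  where
  double : ∀ h → h ℕ.* 2 ≡ h ℕ.+ h
  double = ℕ-Solver.solve-∀
... | suc (suc _) | _ | s≤s (s≤s ())

∣∧<⇒≡0 : ∀ {m k} → m ℕ.∣ k → k ℕ.< m → k ≡ 0
∣∧<⇒≡0 {k = zero}  _   _   = refl
∣∧<⇒≡0 {k = suc _} m∣k k<m = contradiction m∣k (>⇒∤ k<m)

a²≡b²⇒a≡b : ∀ {p} → Prime p → ∀ a b → a ℕ.+ b ℕ.< p → + a * + a ≡ + b * + b mod p → a ≡ b
a²≡b²⇒a≡b {p} pp a b a+b<p (≡-mod p∣a²-b²) =
  [ from-difference , from-sum ]′ (euclidsLemma ∣ + a - + b ∣ (a ℕ.+ b) pp p∣product)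
  where
  difference-of-squares : ∀ a b → a * a - b * b ≡ (a - b) * (a + b)
  difference-of-squares = solve-∀

  p∣product : p ℕ.∣ ∣ + a - + b ∣ ℕ.* (a ℕ.+ b)
  p∣product = subst (p ℕ.∣_) (abs-* (+ a - + b) (+ (a ℕ.+ b)))
                (∣⇒∣ᵤ (subst (+ p ∣_) (difference-of-squares (+ a) (+ b)) p∣a²-b²))

  from-difference : p ℕ.∣ ∣ + a - + b ∣ → a ≡ b
  from-difference p∣∣a-b∣ = +-injective (i-j≡0⇒i≡j (+ a) (+ b) (∣i∣≡0⇒i≡0
    (∣∧<⇒≡0 p∣∣a-b∣ (ℕ.≤-<-trans (∣i-j∣≤∣i∣+∣j∣ (+ a) (+ b)) a+b<p))))

  from-sum : p ℕ.∣ a ℕ.+ b → a ≡ b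
  from-sum p∣a+b = trans (ℕ.m+n≡0⇒m≡0 a a+b≡0) (sym (ℕ.m+n≡0⇒n≡0 a a+b≡0))
    where
    a+b≡0 : a ℕ.+ b ≡ 0
    a+b≡0 = ∣∧<⇒≡0 p∣a+b a+b<p

splitAt-injective : ∀ m {n} {i j : Fin (m ℕ.+ n)} → splitAt m i ≡ splitAt m j → i ≡ j
splitAt-injective m {n} {i} {j} eq =
  trans (sym (join-splitAt m n i)) (trans (cong (join m n) eq) (join-splitAt m n j))

sum-of-two-squares-mod : ∀ {p} → Prime p → p ≢ 2 → ∀ c → Σ ℤ λ a → Σ ℤ λ b → a * a + b * b ≡ c mod p
sum-of-two-squares-mod {p} pp p≢2 c =
  let i , j , i<j , same-residue = pigeonhole more-values-than-residues (residue p ∘ value ∘ splitAt (suc h))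
  in collision (splitAt (suc h) i) (splitAt (suc h) j) (distinct i<j) (same-residue⇒≡-mod same-residue)
  where
  instance
    p≢0 : ℕ.NonZero p
    p≢0 = prime⇒nonZero pp

  h : ℕ
  h = p / 2

  p≡2h+1 : p ≡ suc (h ℕ.+ h)
  p≡2h+1 = odd-prime≡2h+1 pp p≢2

  square : Fin (suc h) → ℤ
  square a = + toℕ a * + toℕ a

  value : Fin (suc h) ⊎ Fin (suc h) → ℤ
  value (inj₁ a) = square a
  value (inj₂ b) = c - square b

  more-values-than-residues : p ℕ.< suc h ℕ.+ suc h
  more-values-than-residues =
    subst (ℕ._< suc h ℕ.+ suc h) (sym p≡2h+1) (s≤s (ℕ.+-monoʳ-< h (ℕ.n<1+n h)))

  distinct : ∀ {i j} → i F.< j → splitAt (suc h) i ≢ splitAt (suc h) j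
  distinct i<j eq = <-irrefl (splitAt-injective (suc h) eq) i<j

  square-injective : ∀ {a b} → square a ≡ square b mod p → a ≡ b
  square-injective {a} {b} = toℕ-injective ∘ a²≡b²⇒a≡b pp (toℕ a) (toℕ b)
    (subst (toℕ a ℕ.+ toℕ b ℕ.<_) (sym p≡2h+1) (s≤s (ℕ.+-mono-≤ (ℕ.s≤s⁻¹ (toℕ<n a)) (ℕ.s≤s⁻¹ (toℕ<n b)))))

  collision : ∀ s t → s ≢ t → value s ≡ value t mod p → Σ ℤ λ a → Σ ℤ λ b → a * a + b * b ≡ c mod p
  collision (inj₁ a) (inj₁ b) s≢t a²≡b² = contradiction (cong inj₁ (square-injective a²≡b²)) s≢t
  collision (inj₂ a) (inj₂ b) s≢t eq    = contradiction (cong inj₂ (sym (square-injective (c-x≡c-y⇒y≡x {c = c} eq)))) s≢t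
  collision (inj₁ a) (inj₂ b) _   eq    = + toℕ a , + toℕ b , x≡c-y⇒x+y≡c {c = c} eq
  collision (inj₂ b) (inj₁ a) _   eq    = + toℕ a , + toℕ b , x≡c-y⇒x+y≡c {c = c} (≡-mod-sym eq)

f-sum-of-squares : ∀ x y z → f x y z ≡ x * x + (x - + 5 * y) * (x - + 5 * y) + (x - + 5 * z) * (x - + 5 * z)
f-sum-of-squares = expanded
  where
  expanded : ∀ x y z → + 3 * (x * x) + + 25 * (y * y) + + 25 * (z * z) - + 10 * (x * y) - + 10 * (x * z)
                       ≡ x * x + (x - + 5 * y) * (x - + 5 * y) + (x - + 5 * z) * (x - + 5 * z)
  expanded = solve-∀

g-sum-of-squares : ∀ x y z → g x y z ≡ x * x + (x - + 5 * y) * (x - + 5 * y) + (+ 5 * z) * (+ 5 * z)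
g-sum-of-squares = expanded
  where
  expanded : ∀ x y z → + 2 * (x * x) + + 25 * (y * y) + + 25 * (z * z) - + 10 * (x * y)
                       ≡ x * x + (x - + 5 * y) * (x - + 5 * y) + (+ 5 * z) * (+ 5 * z)
  expanded = solve-∀

f≡3x² : ∀ x y z → f x y z ≡ + 3 * (x * x) mod 5
f≡3x² x y z = begin
  f x y z                                                                ≡⟨ f-sum-of-squares x y z ⟩
  x * x + (x - + 5 * y) * (x - + 5 * y) + (x - + 5 * z) * (x - + 5 * z)  ≈⟨ +-cong-mod (+-cong-mod (≡-mod-refl {a = x * x}) (square-cong-mod (x-my≡x 5 x y)))
                                                                                      (square-cong-mod (x-my≡x 5 x z)) ⟩
  x * x + x * x + x * x                                                  ≡⟨ triple x ⟩
  + 3 * (x * x)                                                          ∎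
  where
  open ≡-mod-Reasoning 5
  triple : ∀ x → x * x + x * x + x * x ≡ + 3 * (x * x)
  triple = solve-∀

g≡2x² : ∀ x y z → g x y z ≡ + 2 * (x * x) mod 5
g≡2x² x y z = begin
  g x y z                                                        ≡⟨ g-sum-of-squares x y z ⟩
  x * x + (x - + 5 * y) * (x - + 5 * y) + (+ 5 * z) * (+ 5 * z)  ≈⟨ +-cong-mod (+-cong-mod (≡-mod-refl {a = x * x}) (square-cong-mod (x-my≡x 5 x y)))
                                                                              (square-cong-mod (my≡0 5 z)) ⟩
  x * x + x * x + 0ℤ * 0ℤ                                        ≡⟨ double x ⟩
  + 2 * (x * x)                                                  ∎
  where
  open ≡-mod-Reasoning 5
  double : ∀ x → x * x + x * x + 0ℤ * 0ℤ ≡ + 2 * (x * x)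
  double = solve-∀

x≡0⇒f≡0 : ∀ {x} y z → x ≡ 0ℤ mod 5 → f x y z ≡ 0ℤ mod 25
x≡0⇒f≡0 {x} y z (≡-mod (divides t x-0≡t5)) = ≡-mod (divides (t * t + (t - y) * (t - y) + (t - z) * (t - z)) (begin
  f x y z - 0ℤ                ≡⟨ cong (λ u → f u y z - 0ℤ) (trans (sym (+-identityʳ x)) x-0≡t5) ⟩
  f (t * + 5) y z - 0ℤ        ≡⟨ cong (_- 0ℤ) (f-sum-of-squares (t * + 5) y z) ⟩
  t * + 5 * (t * + 5) + (t * + 5 - + 5 * y) * (t * + 5 - + 5 * y) + (t * + 5 - + 5 * z) * (t * + 5 - + 5 * z) - 0ℤ
                              ≡⟨ identity t y z ⟩
  (t * t + (t - y) * (t - y) + (t - z) * (t - z)) * + 25 ∎))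
  where
  open ≡-Reasoning
  identity : ∀ t y z →
    t * + 5 * (t * + 5) + (t * + 5 - + 5 * y) * (t * + 5 - + 5 * y) + (t * + 5 - + 5 * z) * (t * + 5 - + 5 * z) - 0ℤ
    ≡ (t * t + (t - y) * (t - y) + (t - z) * (t - z)) * + 25
  identity = solve-∀

-- Local representations

constant-coherent : ∀ p x → Coherent p (λ _ → x)
constant-coherent p x k = ∣⇒∣ᵤ (∣-difference (≡-mod-refl {a = x}))

representsZp-along-z : ∀ p n x y D w z₀ → D * D * + p ∣ f x y z₀ - + n →
                       D * + p ∣ + 10 * (+ 5 * z₀ - x) * w - D → RepresentsZp p f n
representsZp-along-z p n x y D w z₀ value slope =
  lift (hensel p {F} {F′} (+ 25) (expand x y (+ n)) (expand′ x) D w z₀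
               (subst (λ v → D * D * + p ∣ v - + n) (f-sum-of-squares x y z₀) value) slope)
  where
  F F′ : ℤ → ℤ
  F z = x * x + (x - + 5 * y) * (x - + 5 * y) + (x - + 5 * z) * (x - + 5 * z) - + n
  F′ z = + 10 * (+ 5 * z - x)

  expand : ∀ x y N t s →
    x * x + (x - + 5 * y) * (x - + 5 * y) + (x - + 5 * (t + s)) * (x - + 5 * (t + s)) - N
    ≡ (x * x + (x - + 5 * y) * (x - + 5 * y) + (x - + 5 * t) * (x - + 5 * t) - N)
      + + 10 * (+ 5 * t - x) * s + + 25 * (s * s)
  expand = solve-∀

  expand′ : ∀ x t s → + 10 * (+ 5 * (t + s) - x) ≡ + 10 * (+ 5 * t - x) + + 2 * + 25 * s
  expand′ = solve-∀

  lift : ZpRoot p F → RepresentsZp p f n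
  lift (z , z-coherent , z-root) =
    (λ _ → x) , (λ _ → y) , z , constant-coherent p x , constant-coherent p y , z-coherent ,
    λ k → subst (λ v → + (p ^ k) Unsigned.∣ v - + n) (sym (f-sum-of-squares x y (z k))) (z-root k)

representsZp-along-x : ∀ p n D w x₀ → D * D * + p ∣ f x₀ 0ℤ 0ℤ - + n →
                       D * + p ∣ + 6 * x₀ * w - D → RepresentsZp p f n
representsZp-along-x p n D w x₀ value slope =
  lift (hensel p {F} {F′} (+ 3) (expand (+ n)) expand′ D w x₀
               (subst (λ v → D * D * + p ∣ v - + n) (f-on-x-axis x₀) value) slope)
  where
  F F′ : ℤ → ℤ
  F x = + 3 * (x * x) - + n
  F′ x = + 6 * x

  f-on-x-axis : ∀ x → f x 0ℤ 0ℤ ≡ + 3 * (x * x)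
  f-on-x-axis x = trans (f-sum-of-squares x 0ℤ 0ℤ) (three-squares x)
    where
    three-squares : ∀ x → x * x + (x - + 5 * 0ℤ) * (x - + 5 * 0ℤ) + (x - + 5 * 0ℤ) * (x - + 5 * 0ℤ) ≡ + 3 * (x * x)
    three-squares = solve-∀

  expand : ∀ N t s → + 3 * ((t + s) * (t + s)) - N ≡ (+ 3 * (t * t) - N) + + 6 * t * s + + 3 * (s * s)
  expand = solve-∀

  expand′ : ∀ t s → + 6 * (t + s) ≡ + 6 * t + + 2 * + 3 * s
  expand′ = solve-∀

  lift : ZpRoot p F → RepresentsZp p f n
  lift (x , x-coherent , x-root) =
    x , (λ _ → 0ℤ) , (λ _ → 0ℤ) , x-coherent , constant-coherent p 0ℤ , constant-coherent p 0ℤ ,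
    λ k → subst (λ v → + (p ^ k) Unsigned.∣ v - + n) (sym (f-on-x-axis (x k))) (x-root k)

representsZp-2 : ∀ n → SquareFree n → n % 8 ≢ 7 → RepresentsZp 2 f n
representsZp-2 n squarefree n%8≢7 = by-residue (n % 8) refl (m%n<n n 8)
  where
  lift : ∀ {r} → n % 8 ≡ r → ∀ x y z₀ → f x y z₀ ≡ + r mod 8 → + 10 * (+ 5 * z₀ - x) ≡ + 2 mod 4 →
         RepresentsZp 2 f n
  lift n%8≡r x y z₀ value (≡-mod slope) =
    representsZp-along-z 2 n x y (+ 2) (+ 1) z₀
      (∣-difference (≡-mod-trans value (≡-mod-sym (n%m≡r⇒n≡r n%8≡r))))
      (subst (λ v → + 4 ∣ v - + 2) (sym (*-identityʳ (+ 10 * (+ 5 * z₀ - x)))) slope)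

  4∤n : ¬ 4 ℕ.∣ n
  4∤n 4∣n with squarefree 2 4∣n
  ... | ()

  4∣n : ∀ {r} → n % 8 ≡ r → r % 4 ≡ 0 → 4 ℕ.∣ n
  4∣n n%8≡r r%4≡0 = m%n≡0⇒n∣m n 4
    (trans (sym (m∣n⇒o%n%m≡o%m 4 8 n (ℕ.divides 2 refl))) (trans (cong (_% 4) n%8≡r) r%4≡0))

  by-residue : ∀ r → n % 8 ≡ r → r < 8 → RepresentsZp 2 f n
  by-residue 0 n%8≡0 _ = contradiction (4∣n n%8≡0 refl) 4∤n
  by-residue 1 n%8≡1 _ = lift n%8≡1 (+ 0) (+ 0) (+ 1) (≡-mod (divides (+ 3) refl)) (≡-mod (divides (+ 12) refl))
  by-residue 2 n%8≡2 _ = lift n%8≡2 (+ 1) (+ 1) (+ 0) (≡-mod (divides (+ 2) refl)) (≡-mod (divides (- + 3) refl))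
  by-residue 3 n%8≡3 _ = lift n%8≡3 (+ 1) (+ 0) (+ 0) (≡-mod (divides (+ 0) refl)) (≡-mod (divides (- + 3) refl))
  by-residue 4 n%8≡4 _ = contradiction (4∣n n%8≡4 refl) 4∤n
  by-residue 5 n%8≡5 _ = lift n%8≡5 (+ 2) (+ 2) (+ 1) (≡-mod (divides (+ 9) refl)) (≡-mod (divides (+ 7) refl))
  by-residue 6 n%8≡6 _ = lift n%8≡6 (+ 2) (+ 1) (+ 1) (≡-mod (divides (+ 2) refl)) (≡-mod (divides (+ 7) refl))
  by-residue 7 n%8≡7 _ = contradiction n%8≡7 n%8≢7
  by-residue (suc (suc (suc (suc (suc (suc (suc (suc r)))))))) _ r+8<8 = contradiction r+8<8 (ℕ.m+n≮m 8 r)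

representsZp-5 : ∀ n → n % 5 ≡ 2 ⊎ n % 5 ≡ 3 → RepresentsZp 5 f n
representsZp-5 n = by-residue
  where
  lift : ∀ {r} → n % 5 ≡ r → ∀ x₀ w → f x₀ 0ℤ 0ℤ ≡ + r mod 5 → + 6 * x₀ * w ≡ + 1 mod 5 → RepresentsZp 5 f n
  lift n%5≡r x₀ w value slope =
    representsZp-along-x 5 n (+ 1) w x₀ (∣-difference (≡-mod-trans value (≡-mod-sym (n%m≡r⇒n≡r n%5≡r)))) (∣-difference slope)

  by-residue : n % 5 ≡ 2 ⊎ n % 5 ≡ 3 → RepresentsZp 5 f n
  by-residue (inj₁ n%5≡2) = lift n%5≡2 (+ 2) (+ 3) (≡-mod (divides (+ 2) refl)) (≡-mod (divides (+ 7) refl))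
  by-residue (inj₂ n%5≡3) = lift n%5≡3 (+ 1) (+ 1) (≡-mod (divides (+ 0) refl)) (≡-mod (divides (+ 1) refl))

representsZp-from-two-squares : ∀ {p} n a b α → a * a + b * b ≡ + n - + 1 mod p → + 10 * α ≡ + 1 mod p →
                                RepresentsZp p f n
representsZp-from-two-squares {p} n a b α a²+b²≡n-1 10α≡1 =
  representsZp-along-z p n a y (+ 1) (- α) z₀ (unit-modulus (∣-difference value)) (unit-modulus (∣-difference slope))
  where
  open ≡-mod-Reasoning p

  y z₀ : ℤ
  y = (a - b) * (+ 2 * α)
  z₀ = (a - + 1) * (+ 2 * α)

  unit-modulus : ∀ {v} → + p ∣ v → + 1 * + p ∣ v
  unit-modulus = subst (_∣ _) (sym (*-identityˡ (+ p)))

  a-5[a-c]2α≡c : ∀ c → a - + 5 * ((a - c) * (+ 2 * α)) ≡ c mod p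
  a-5[a-c]2α≡c c = ≡-mod (subst (+ p ∣_) (identity a c α) (∣n⇒∣m*n (c - a) (∣-difference 10α≡1)))
    where
    identity : ∀ a c α → (c - a) * (+ 10 * α - + 1) ≡ a - + 5 * ((a - c) * (+ 2 * α)) - c
    identity = solve-∀

  value : f a y z₀ ≡ + n mod p
  value = begin
    f a y z₀                                                                 ≡⟨ f-sum-of-squares a y z₀ ⟩
    a * a + (a - + 5 * y) * (a - + 5 * y) + (a - + 5 * z₀) * (a - + 5 * z₀)  ≈⟨ +-cong-mod (+-cong-mod (≡-mod-refl {a = a * a}) (square-cong-mod (a-5[a-c]2α≡c b)))
                                                                                          (square-cong-mod (a-5[a-c]2α≡c (+ 1))) ⟩
    a * a + b * b + + 1                                                      ≈⟨ +-cong-mod a²+b²≡n-1 (≡-mod-refl {a = + 1}) ⟩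
    + n - + 1 + + 1                                                          ≡⟨ cancel (+ n) ⟩
    + n                                                                      ∎
    where
    cancel : ∀ N → N - + 1 + + 1 ≡ N
    cancel = solve-∀

  slope : + 10 * (+ 5 * z₀ - a) * - α ≡ + 1 mod p
  slope = begin
    + 10 * (+ 5 * z₀ - a) * - α   ≡⟨ rearrange a z₀ α ⟩
    + 10 * α * (a - + 5 * z₀)     ≈⟨ *-cong-mod 10α≡1 (a-5[a-c]2α≡c (+ 1)) ⟩
    + 1                           ∎
    where
    rearrange : ∀ a z α → + 10 * (+ 5 * z - a) * - α ≡ + 10 * α * (a - + 5 * z)
    rearrange = solve-∀

representedByGenus-f : ∀ n → SquareFree n → n % 8 ≢ 7 → n % 5 ≡ 2 ⊎ n % 5 ≡ 3 → RepresentedByGenus f n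
representedByGenus-f n squarefree n%8≢7 n%5≡2∨3 p pp with p ℕ.≟ 2 | p ℕ.≟ 5
... | yes refl | _        = representsZp-2 n squarefree n%8≢7
... | no _     | yes refl = representsZp-5 n n%5≡2∨3
... | no p≢2   | no p≢5   =
  let a , b , a²+b²≡n-1 = sum-of-two-squares-mod pp p≢2 (+ n - + 1)
      α , 10α≡1 = inverse-mod-prime 10 pp (prime∤10 pp p≢2 p≢5)
  in representsZp-from-two-squares n a b α a²+b²≡n-1 10α≡1

-- Local obstructions

r₁²+r₂²+r₃²≢7 : ∀ (r₁ r₂ r₃ : Fin 8) → ¬ + toℕ r₁ * + toℕ r₁ + + toℕ r₂ * + toℕ r₂ + + toℕ r₃ * + toℕ r₃ ≡ + 7 mod 8
r₁²+r₂²+r₃²≢7 = toWitness {a? = all? λ r₁ → all? λ r₂ → all? λ r₃ → ¬? (_ ≡? + 7 mod 8)} _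

u²+v²+w²≢7 : ∀ u v w → ¬ u * u + v * v + w * w ≡ + 7 mod 8
u²+v²+w²≢7 u v w u²+v²+w²≡7 =
  r₁²+r₂²+r₃²≢7 (residue 8 u) (residue 8 v) (residue 8 w)
    (≡-mod-trans (≡-mod-sym (+-cong-mod (+-cong-mod (square u) (square v)) (square w))) u²+v²+w²≡7)
  where
  square : ∀ x → x * x ≡ + toℕ (residue 8 x) * + toℕ (residue 8 x) mod 8
  square x = square-cong-mod (x≡residue x 8)

representsZp-2⇒n%8≢7 : ∀ n → RepresentsZp 2 f n → n % 8 ≢ 7
representsZp-2⇒n%8≢7 n (x , y , z , _ , _ , _ , root) n%8≡7 =
  u²+v²+w²≢7 (x 3) (x 3 - + 5 * y 3) (x 3 - + 5 * z 3) (begin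
    x 3 * x 3 + (x 3 - + 5 * y 3) * (x 3 - + 5 * y 3) + (x 3 - + 5 * z 3) * (x 3 - + 5 * z 3)
                                    ≡⟨ sym (f-sum-of-squares (x 3) (y 3) (z 3)) ⟩
    f (x 3) (y 3) (z 3)             ≈⟨ ≡-mod (∣ᵤ⇒∣ (root 3)) ⟩
    + n                             ≈⟨ n%m≡r⇒n≡r n%8≡7 ⟩
    + 7                             ∎)
  where
  open ≡-mod-Reasoning 8

3r²≡c⇒r≡0∨c≡2∨c≡3 : ∀ (r c : Fin 5) → + 3 * (+ toℕ r * + toℕ r) ≡ + toℕ c mod 5 →
                     r ≡ F.zero ⊎ toℕ c ≡ 2 ⊎ toℕ c ≡ 3
3r²≡c⇒r≡0∨c≡2∨c≡3 = toWitness {a? = all? λ r → all? λ c →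
  (_ ≡? _ mod 5) →-dec (r F.≟ F.zero ⊎-dec (toℕ c ℕ.≟ 2 ⊎-dec toℕ c ℕ.≟ 3))} _

representsZp-5⇒n%5≡2∨3 : ∀ n → SquareFree n → RepresentsZp 5 f n → n % 5 ≡ 2 ⊎ n % 5 ≡ 3
representsZp-5⇒n%5≡2∨3 n squarefree (x , y , z , _ , _ , _ , root) =
  conclude (3r²≡c⇒r≡0∨c≡2∨c≡3 (residue 5 X) (residue 5 (+ n)) 3r²≡c)
  where
  X Y Z : ℤ
  X = x 2
  Y = y 2
  Z = z 2

  f≡n : f X Y Z ≡ + n mod 25
  f≡n = ≡-mod (∣ᵤ⇒∣ (root 2))

  X≡r : X ≡ + toℕ (residue 5 X) mod 5
  X≡r = x≡residue X 5

  3r²≡c : + 3 * (+ toℕ (residue 5 X) * + toℕ (residue 5 X)) ≡ + toℕ (residue 5 (+ n)) mod 5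
  3r²≡c = begin
    + 3 * (+ toℕ (residue 5 X) * + toℕ (residue 5 X))  ≈⟨ ≡-mod-sym (*-cong-mod (≡-mod-refl {a = + 3}) (square-cong-mod X≡r)) ⟩
    + 3 * (X * X)                                      ≈⟨ ≡-mod-sym (f≡3x² X Y Z) ⟩
    f X Y Z                                            ≈⟨ ≡-mod-weaken (ℕ.divides 5 refl) f≡n ⟩
    + n                                                ≈⟨ x≡residue (+ n) 5 ⟩
    + toℕ (residue 5 (+ n))                            ∎
    where open ≡-mod-Reasoning 5

  25∤n : ¬ 25 ℕ.∣ n
  25∤n 25∣n with squarefree 5 25∣n
  ... | ()

  25∣n : residue 5 X ≡ F.zero → 25 ℕ.∣ n
  25∣n r≡0 = n≡0⇒m∣n (≡-mod-trans (≡-mod-sym f≡n) (x≡0⇒f≡0 Y Z (subst (λ r → X ≡ + toℕ r mod 5) r≡0 X≡r)))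

  c≡n%5 : toℕ (residue 5 (+ n)) ≡ n % 5
  c≡n%5 = toℕ-fromℕ< (m%n<n n 5)

  conclude : residue 5 X ≡ F.zero ⊎ toℕ (residue 5 (+ n)) ≡ 2 ⊎ toℕ (residue 5 (+ n)) ≡ 3 → n % 5 ≡ 2 ⊎ n % 5 ≡ 3
  conclude (inj₁ r≡0)         = contradiction (25∣n r≡0) 25∤n
  conclude (inj₂ (inj₁ c≡2)) = inj₁ (trans (sym c≡n%5) c≡2)
  conclude (inj₂ (inj₂ c≡3)) = inj₂ (trans (sym c≡n%5) c≡3)

nonunit-square : ∀ {m} k N x U → N ≡ k * (x * x) mod m → U ≡ x mod m → ¬ N ≡ k mod m → U * U - + 1 ≢ 0ℤ
nonunit-square {m} k N x U N≡kx² U≡x N≢k U²-1≡0 = N≢k (begin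
  N              ≈⟨ N≡kx² ⟩
  k * (x * x)    ≈⟨ *-cong-mod (≡-mod-refl {a = k}) (square-cong-mod (≡-mod-sym U≡x)) ⟩
  k * (U * U)    ≈⟨ *-cong-mod (≡-mod-refl {a = k}) (≡-mod (divides 0ℤ U²-1≡0)) ⟩
  k * + 1        ≡⟨ *-identityʳ k ⟩
  k              ∎)
  where open ≡-mod-Reasoning m

i*j*k≢0 : ∀ {a b c} → a ≢ 0ℤ → b ≢ 0ℤ → c ≢ 0ℤ → a * b * c ≢ 0ℤ
i*j*k≢0 {a} a≢0 b≢0 c≢0 =
  [ [ a≢0 , b≢0 ]′ ∘ i*j≡0⇒i≡0∨j≡0 a , c≢0 ]′ ∘ i*j≡0⇒i≡0∨j≡0 _

represents-f⇒nonunit-squares : ∀ n → n % 5 ≡ 2 → Represents f n → SumOfThreeNonunitSquares n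
represents-f⇒nonunit-squares n n%5≡2 (x , y , z , fxyz≡n) =
  x , x - + 5 * y , x - + 5 * z , trans (sym fxyz≡n) (f-sum-of-squares x y z) ,
  i*j*k≢0 (nonunit x ≡-mod-refl) (nonunit (x - + 5 * y) (x-my≡x 5 x y)) (nonunit (x - + 5 * z) (x-my≡x 5 x z))
  where
  nonunit : ∀ U → U ≡ x mod 5 → U * U - + 1 ≢ 0ℤ
  nonunit U U≡x = nonunit-square (+ 3) (+ n) x U
    (≡-mod-trans (≡⇒≡-mod (sym fxyz≡n)) (f≡3x² x y z)) U≡x
    (n%m≡r⇒n≢s n%5≡2 (toWitnessFalse {a? = + 2 ≡? + 3 mod 5} _))

represents-g⇒nonunit-squares : ∀ n → n % 5 ≡ 3 → Represents g n → SumOfThreeNonunitSquares n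
represents-g⇒nonunit-squares n n%5≡3 (x , y , z , gxyz≡n) =
  x , x - + 5 * y , + 5 * z , trans (sym gxyz≡n) (g-sum-of-squares x y z) ,
  i*j*k≢0 (nonunit x ≡-mod-refl) (nonunit (x - + 5 * y) (x-my≡x 5 x y))
    (nonunit-square (+ 1) 0ℤ 0ℤ (+ 5 * z) ≡-mod-refl (my≡0 5 z) (toWitnessFalse {a? = 0ℤ ≡? + 1 mod 5} _))
  where
  nonunit : ∀ U → U ≡ x mod 5 → U * U - + 1 ≢ 0ℤ
  nonunit U U≡x = nonunit-square (+ 2) (+ n) x U
    (≡-mod-trans (≡⇒≡-mod (sym gxyz≡n)) (g≡2x² x y z)) U≡x
    (n%m≡r⇒n≢s n%5≡3 (toWitnessFalse {a? = + 3 ≡? + 2 mod 5} _))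

lemma3p1 : (n : ℕ) → 0 < n →
    (SquareFree n →
      (RepresentedByGenus f n ⇔ ((n % 8 ≢ 7) × (n % 5 ≡ 2 ⊎ n % 5 ≡ 3))))
    × (n % 5 ≡ 2 → Represents f n → SumOfThreeNonunitSquares n)
    × (n % 5 ≡ 3 → Represents g n → SumOfThreeNonunitSquares n)
lemma3p1 n _ =
  (λ squarefree → mk⇔
    (λ genus → representsZp-2⇒n%8≢7 n (genus 2 prime[2]) , representsZp-5⇒n%5≡2∨3 n squarefree (genus 5 prime[5]))
    (λ (n%8≢7 , n%5≡2∨3) → representedByGenus-f n squarefree n%8≢7 n%5≡2∨3)) ,
  represents-f⇒nonunit-squares n ,
  represents-g⇒nonunit-squares n
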